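{- Let $v,k$ be positive integers with $v\mid k^2$ and $k\mid v$, and let $\lambda=k^2/v$. In $\mathbb{Z}_v$ let $A_X=\{0,1,\ldots,k-1\}$ and $A_Y=\{ak, ak+1,\ldots, ak+\lambda-1 : a=0,1,\ldots,\frac{v}{k}-1\}$. Then (i) $\{A_X,A_Y\}$ is a $(v,2,k,\lambda)$-PSEDF in $\mathbb{Z}_v$, and (ii) $\{A_X,A_Y\}$ is a non-disjoint $(v,2,k,\lambda)$-SEDF in $\mathbb{Z}_v$.
   Context: Groups are written additively. For subsets $A,B$ of a group $G$, $\Delta(A,B)$ denotes the multiset $\{a-b: a\in A, b\in B\}$. For a group $G$ of order $v$ and $m>1$, a family of $k$-subsets $\{A_1,\ldots,A_m\}$ of $G$ is a $(v,m,k,\lambda)$-PSEDF if for every pair $i\neq j$ the multiset $\Delta(A_i,A_j)$ contains every element of $G$ exactly $\lambda$ times. It is a non-disjoint $(v,m,k,\lambda)$-SEDF if for each $i$ the multiset union $\bigcup_{j\neq i}\Delta(A_i,A_j)$ contains every element of $G$ (including $0$) exactly $\lambda$ times. -}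

module Defs where

open import Data.Nat using (ℕ; zero; suc; _+_; _*_; _∸_; _<_; NonZero)
open import Data.Nat.DivMod using (_mod_; _/_)
open import Data.Fin using (Fin; toℕ)
open import Data.Fin.Properties using (_≟_)
open import Data.List using (List; []; _∷_; map; concatMap; filter; length; upTo; allFin)
open import Data.List.Relation.Unary.Unique.Propositional using (Unique)
open import Relation.Binary.PropositionalEquality using (_≡_; _≢_)
open import Relation.Nullary using (¬?)
open import Data.Product using (_×_)

-- The cyclic group Z_v is modelled as Fin v with arithmetic mod v.
-- Subtraction in Z_v: a - b = (a + (v - b)) mod v.
_−_ : ∀ {v} .{{_ : NonZero v}} → Fin v → Fin v → Fin v
_−_ {v} a b = (toℕ a + (v ∸ toℕ b)) mod v

Δ : ∀ {v} .{{_ : NonZero v}} → List (Fin v) → List (Fin v) → List (Fin v)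
Δ A B = concatMap (λ a → map (λ b → a − b) B) A

count : ∀ {v} → Fin v → List (Fin v) → ℕ
count g L = length (filter (λ x → g ≟ x) L)

IsKSubset : ∀ {v} → ℕ → List (Fin v) → Set
IsKSubset k A = Unique A × length A ≡ k

IsPSEDF : (v m k lam : ℕ) .{{_ : NonZero v}} → (Fin m → List (Fin v)) → Set
IsPSEDF v m k lam A =
  (1 < m) × ((i : Fin m) → IsKSubset k (A i)) ×
  ((i j : Fin m) → i ≢ j → (g : Fin v) → count g (Δ (A i) (A j)) ≡ lam)

ΔOthers : ∀ {v m} .{{_ : NonZero v}} → (Fin m → List (Fin v)) → Fin m → List (Fin v)
ΔOthers {m = m} A i = concatMap (λ j → Δ (A i) (A j)) (filter (λ j → ¬? (i ≟ j)) (allFin m))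

IsNonDisjointSEDF : (v m k lam : ℕ) .{{_ : NonZero v}} → (Fin m → List (Fin v)) → Set
IsNonDisjointSEDF v m k lam A =
  (1 < m) × ((i : Fin m) → IsKSubset k (A i)) ×
  ((i : Fin m) → (g : Fin v) → count g (ΔOthers A i) ≡ lam)

AX : (v k : ℕ) .{{_ : NonZero v}} → List (Fin v)
AX v k = map (λ t → t mod v) (upTo k)

AY : (v k : ℕ) .{{_ : NonZero v}} .{{_ : NonZero k}} → List (Fin v)
AY v k = concatMap (λ a → map (λ t → (a * k + t) mod v) (upTo ((k * k) / v))) (upTo (v / k))

family : (v k : ℕ) .{{_ : NonZero v}} .{{_ : NonZero k}} → Fin 2 → List (Fin v)
family v k Fin.zero = AX v k
family v k (Fin.suc _) = AY v k

{-# OPTIONS --safe #-}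
-- Fix g ∈ ℤ_v. A pair (x, y) ∈ A_X × A_Y has x − y = g exactly when x = g + y, so each
-- y ∈ A_Y contributes 1 to the multiplicity of g in Δ(A_X, A_Y) if g + y lies in the
-- window [0, k) = A_X and 0 otherwise; for Δ(A_Y, A_X) the condition is y − g ∈ [0, k).
-- Writing y = ak + t (a < v/k, t < λ), for fixed t the v/k translates c + t + ak of any
-- c meet the window exactly once, because v = (v/k)·k: the count is k-periodic in c
-- and equals 1 for c < k. Summing over t gives λ. For m = 2 the union in the SEDF
-- condition consists of a single Δ, so (ii) is (i) again.
module Submission where

open import Defs
open import Data.Nat using (ℕ; zero; suc; _+_; _*_; _∸_; _<_; _≤_; NonZero; >-nonZero; ≢-nonZero⁻¹; z<s; s<s)
open import Data.Nat.Properties hiding (_≟_)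
import Data.Nat.Properties as ℕ
open import Algebra.Properties.CommutativeSemigroup +-commutativeSemigroup using (interchange)
open import Data.Nat.DivMod
open import Data.Nat.Divisibility using (_∣_; ∣⇒≤; n∣m*n)
open import Data.Nat.ListAction using (sum)
open import Data.Nat.ListAction.Properties using (sum-++)
open import Data.Fin using (Fin; toℕ)
open import Data.Fin.Properties using (_≟_; toℕ-fromℕ<; toℕ-injective; toℕ<n)
open import Data.List using (List; []; _∷_; _++_; map; concatMap; length; upTo)
open import Data.List.Properties using (map-++; map-∘; length-++; length-map; length-upTo; upTo-∷ʳ; map-upTo; map-applyUpTo; ++-identityʳ)
open import Data.List.Membership.Propositional using (_∈_)
open import Data.List.Membership.Propositional.Properties using (∈-upTo⁻)
open import Data.List.Relation.Unary.Any using (here; there)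
open import Data.List.Relation.Unary.All as All using (All; []; _∷_)
import Data.List.Relation.Unary.All.Properties as All
open import Data.List.Relation.Unary.AllPairs using (AllPairs; []; _∷_)
open import Data.List.Relation.Binary.Disjoint.Propositional using (Disjoint)
open import Data.List.Relation.Unary.Unique.Propositional using (Unique)
import Data.List.Relation.Unary.Unique.Propositional.Properties as Unique
open import Data.Product using (_×_; _,_)
open import Data.Sum using ([_,_])
open import Function using (_∘_; _⇔_; mk⇔; Equivalence)
import Function.Properties.Equivalence as ⇔
open import Relation.Binary.PropositionalEquality using (_≡_; _≢_; refl; sym; trans; cong; cong₂; subst; module ≡-Reasoning)
open import Relation.Nullary using (Dec; yes; no; ¬_; contradiction)

χ : {P : Set} → Dec P → ℕ
χ (yes _) = 1
χ (no _)  = 0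

χ-yes : {P : Set} (P? : Dec P) → P → χ P? ≡ 1
χ-yes (yes _) _ = refl
χ-yes (no ¬p) p = contradiction p ¬p

χ-no : {P : Set} (P? : Dec P) → ¬ P → χ P? ≡ 0
χ-no (yes p) ¬p = contradiction p ¬p
χ-no (no _)  _  = refl

χ-cong : {P Q : Set} (P? : Dec P) (Q? : Dec Q) → P ⇔ Q → χ P? ≡ χ Q?
χ-cong (yes _) (yes _) _   = refl
χ-cong (no _)  (no _)  _   = refl
χ-cong (yes p) (no ¬q) P⇔Q = contradiction (Equivalence.to P⇔Q p) ¬q
χ-cong (no ¬p) (yes q) P⇔Q = contradiction (Equivalence.from P⇔Q q) ¬p

∑ : {A : Set} → List A → (A → ℕ) → ℕ
∑ xs F = sum (map F xs)

syntax ∑ xs (λ x → F) = ∑[ x ∈ xs ] F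

private variable
  A B : Set

∑-++ : (xs ys : List A) (F : A → ℕ) → ∑ (xs ++ ys) F ≡ ∑ xs F + ∑ ys F
∑-++ xs ys F = trans (cong sum (map-++ F xs ys)) (sum-++ (map F xs) (map F ys))

∑-cong : (xs : List A) {F G : A → ℕ} → (∀ {x} → x ∈ xs → F x ≡ G x) → ∑ xs F ≡ ∑ xs G
∑-cong []       F≡G = refl
∑-cong (x ∷ xs) F≡G = cong₂ _+_ (F≡G (here refl)) (∑-cong xs (F≡G ∘ there))

∑-const : (xs : List A) (c : ℕ) → ∑[ x ∈ xs ] c ≡ length xs * c
∑-const []       c = refl
∑-const (x ∷ xs) c = cong (c +_) (∑-const xs c)

∑-+ : (xs : List A) (F G : A → ℕ) → ∑[ x ∈ xs ] (F x + G x) ≡ ∑ xs F + ∑ xs G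
∑-+ []       F G = refl
∑-+ (x ∷ xs) F G = trans (cong (F x + G x +_) (∑-+ xs F G)) (interchange (F x) (G x) (∑ xs F) (∑ xs G))

∑-swap : (xs : List A) (ys : List B) (F : A → B → ℕ) →
         ∑[ x ∈ xs ] ∑[ y ∈ ys ] F x y ≡ ∑[ y ∈ ys ] ∑[ x ∈ xs ] F x y
∑-swap []       ys F = sym (trans (∑-const ys 0) (*-zeroʳ (length ys)))
∑-swap (x ∷ xs) ys F = trans (cong (∑ ys (F x) +_) (∑-swap xs ys F)) (sym (∑-+ ys (F x) _))

∑-map : (f : A → B) (xs : List A) (F : B → ℕ) → ∑ (map f xs) F ≡ ∑ xs (F ∘ f)
∑-map f xs F = cong sum (sym (map-∘ xs))

∑-concatMap : (f : A → List B) (xs : List A) (F : B → ℕ) →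
              ∑ (concatMap f xs) F ≡ ∑[ x ∈ xs ] ∑ (f x) F
∑-concatMap f []       F = refl
∑-concatMap f (x ∷ xs) F = trans (∑-++ (f x) (concatMap f xs) F) (cong (∑ (f x) F +_) (∑-concatMap f xs F))

∑-upTo-suc : (n : ℕ) (F : ℕ → ℕ) → ∑ (upTo (suc n)) F ≡ ∑ (upTo n) F + F n
∑-upTo-suc n F = begin
  ∑ (upTo (suc n)) F       ≡⟨ cong (λ xs → ∑ xs F) (upTo-∷ʳ n) ⟨
  ∑ (upTo n ++ n ∷ []) F   ≡⟨ ∑-++ (upTo n) (n ∷ []) F ⟩
  ∑ (upTo n) F + (F n + 0) ≡⟨ cong (∑ (upTo n) F +_) (+-identityʳ (F n)) ⟩
  ∑ (upTo n) F + F n       ∎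
  where open ≡-Reasoning

∑-rotate : (n : ℕ) (F : ℕ → ℕ) → F n ≡ F 0 → ∑[ i ∈ upTo n ] F (suc i) ≡ ∑ (upTo n) F
∑-rotate n F Fn≡F0 = +-cancelʳ-≡ (F 0) _ _ (begin
  ∑[ i ∈ upTo n ] F (suc i) + F 0   ≡⟨ +-comm _ (F 0) ⟩
  F 0 + ∑[ i ∈ upTo n ] F (suc i)   ≡⟨ cong (λ xs → F 0 + sum xs) (trans (map-upTo (F ∘ suc) n) (sym (map-applyUpTo suc F n))) ⟩
  ∑ (upTo (suc n)) F                ≡⟨ ∑-upTo-suc n F ⟩
  ∑ (upTo n) F + F n                ≡⟨ cong (∑ (upTo n) F +_) Fn≡F0 ⟩
  ∑ (upTo n) F + F 0                ∎)
  where open ≡-Reasoning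

∑-upTo-indicator : (n w : ℕ) → ∑[ i ∈ upTo n ] χ (i ℕ.≟ w) ≡ χ (w ℕ.<? n)
∑-upTo-indicator zero    w = sym (χ-no (w ℕ.<? 0) λ ())
∑-upTo-indicator (suc n) w = begin
  ∑[ i ∈ upTo (suc n) ] χ (i ℕ.≟ w)          ≡⟨ ∑-upTo-suc n _ ⟩
  ∑[ i ∈ upTo n ] χ (i ℕ.≟ w) + χ (n ℕ.≟ w) ≡⟨ cong (_+ χ (n ℕ.≟ w)) (∑-upTo-indicator n w) ⟩
  χ (w ℕ.<? n) + χ (n ℕ.≟ w)                ≡⟨ split (w ℕ.<? n) (n ℕ.≟ w) ⟩
  χ (w ℕ.<? suc n)                          ∎
  where
  open ≡-Reasoning
  split : ∀ {n w} (w<n? : Dec (w < n)) (n≡w? : Dec (n ≡ w)) → χ w<n? + χ n≡w? ≡ χ (w ℕ.<? suc n)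
  split {n} (yes w<n) (yes refl) = contradiction w<n (n≮n n)
  split     (yes w<n) (no _)     = sym (χ-yes _ (m<n⇒m<1+n w<n))
  split {n} (no _)    (yes refl) = sym (χ-yes _ (n<1+n n))
  split     (no w≮n)  (no n≢w)   = sym (χ-no _ ([ w≮n , n≢w ∘ sym ] ∘ m<1+n⇒m<n∨m≡n))

length-concatMap : (f : A → List B) (xs : List A) → length (concatMap f xs) ≡ ∑[ x ∈ xs ] length (f x)
length-concatMap f []       = refl
length-concatMap f (x ∷ xs) = trans (length-++ (f x)) (cong (length (f x) +_) (length-concatMap f xs))

Unique-concatMap : {f : A → List B} (τ : B → A) {xs : List A} → Unique xs →
                   All (λ x → Unique (f x) × All (λ y → τ y ≡ x) (f x)) xs →
                   Unique (concatMap f xs)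
Unique-concatMap {f = f} τ u blocks =
  Unique.concat⁺ (All.map⁺ (All.map (λ (ux , _) → ux) blocks)) (disjoint u blocks)
  where
  disjoint : ∀ {xs} → Unique xs → All (λ x → Unique (f x) × All (λ y → τ y ≡ x) (f x)) xs →
             AllPairs Disjoint (map f xs)
  disjoint []           []                  = []
  disjoint (x∉xs ∷ uxs) ((_ , τx) ∷ blocks) =
    All.map⁺ (All.zipWith (λ (x≢y , (_ , τy)) {_} (z∈fx , z∈fy) → x≢y (trans (sym (All.lookup τx z∈fx)) (All.lookup τy z∈fy)))
                          (x∉xs , blocks))
    ∷ disjoint uxs blocks

module _ {v : ℕ} (g : Fin v) where

  count≡∑ : (xs : List (Fin v)) → count g xs ≡ ∑[ x ∈ xs ] χ (g ≟ x)
  count≡∑ []       = refl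
  count≡∑ (x ∷ xs) with g ≟ x
  ... | yes _ = cong suc (count≡∑ xs)
  ... | no _  = count≡∑ xs

  count-Δ : .{{_ : NonZero v}} (A B : List (Fin v)) → count g (Δ A B) ≡ ∑[ a ∈ A ] ∑[ b ∈ B ] χ (g ≟ a − b)
  count-Δ A B = begin
    count g (Δ A B)                                   ≡⟨ count≡∑ (Δ A B) ⟩
    ∑ (concatMap (λ a → map (a −_) B) A) (χ ∘ (g ≟_)) ≡⟨ ∑-concatMap _ A _ ⟩
    ∑[ a ∈ A ] ∑ (map (a −_) B) (χ ∘ (g ≟_))          ≡⟨ ∑-cong A (λ {a} _ → ∑-map (a −_) B _) ⟩
    ∑[ a ∈ A ] ∑[ b ∈ B ] χ (g ≟ a − b)               ∎
    where open ≡-Reasoning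

[m%d+n]%d≡[m+n]%d : ∀ m n d .{{_ : NonZero d}} → (m % d + n) % d ≡ (m + n) % d
[m%d+n]%d≡[m+n]%d m n d = begin
  (m % d + n) % d         ≡⟨ %-distribˡ-+ (m % d) n d ⟩
  (m % d % d + n % d) % d ≡⟨ cong (λ z → (z + n % d) % d) (m%n%n≡m%n m d) ⟩
  (m % d + n % d) % d     ≡⟨ %-distribˡ-+ m n d ⟨
  (m + n) % d             ∎
  where open ≡-Reasoning

[m+n%d]%d≡[m+n]%d : ∀ m n d .{{_ : NonZero d}} → (m + n % d) % d ≡ (m + n) % d
[m+n%d]%d≡[m+n]%d m n d = begin
  (m + n % d) % d ≡⟨ cong (_% d) (+-comm m (n % d)) ⟩
  (n % d + m) % d ≡⟨ [m%d+n]%d≡[m+n]%d n m d ⟩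
  (n + m) % d     ≡⟨ cong (_% d) (+-comm n m) ⟩
  (m + n) % d     ∎
  where open ≡-Reasoning

[[x+c]%v+d]%v≡x : ∀ {x c d} v .{{_ : NonZero v}} → c + d ≡ v → x < v → ((x + c) % v + d) % v ≡ x
[[x+c]%v+d]%v≡x {x} {c} {d} v c+d≡v x<v = begin
  ((x + c) % v + d) % v ≡⟨ [m%d+n]%d≡[m+n]%d (x + c) d v ⟩
  (x + c + d) % v       ≡⟨ cong (_% v) (trans (+-assoc x c d) (cong (x +_) c+d≡v)) ⟩
  (x + v) % v           ≡⟨ [m+n]%n≡m%n x v ⟩
  x % v                 ≡⟨ m<n⇒m%n≡m x<v ⟩
  x                     ∎
  where open ≡-Reasoning

toℕ-mod : ∀ {x v} .{{_ : NonZero v}} → x < v → toℕ (x mod v) ≡ x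
toℕ-mod x<v = trans (toℕ-fromℕ< _) (m<n⇒m%n≡m x<v)

module _ {v : ℕ} .{{_ : NonZero v}} where

  mod≡⇔≡toℕ : ∀ {x} {w : Fin v} → x < v → x mod v ≡ w ⇔ x ≡ toℕ w
  mod≡⇔≡toℕ x<v = mk⇔ (λ e → trans (sym (toℕ-mod x<v)) (cong toℕ e)) (λ e → toℕ-injective (trans (toℕ-mod x<v) e))

  toℕ-− : (a b : Fin v) → toℕ (a − b) ≡ (toℕ a + (v ∸ toℕ b)) % v
  toℕ-− a b = toℕ-fromℕ< _

  g≡a−b⇔a≡g+b : {g a b : Fin v} → g ≡ a − b ⇔ a ≡ (toℕ g + toℕ b) mod v
  g≡a−b⇔a≡g+b {g} {a} {b} = mk⇔ to from
    where
    open ≡-Reasoning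
    to : ∀ {g} → g ≡ a − b → a ≡ (toℕ g + toℕ b) mod v
    to refl = toℕ-injective (begin
      toℕ a                                   ≡⟨ [[x+c]%v+d]%v≡x v (m∸n+n≡m (<⇒≤ (toℕ<n b))) (toℕ<n a) ⟨
      ((toℕ a + (v ∸ toℕ b)) % v + toℕ b) % v ≡⟨ cong (λ z → (z + toℕ b) % v) (toℕ-− a b) ⟨
      (toℕ (a − b) + toℕ b) % v               ≡⟨ toℕ-fromℕ< _ ⟨
      toℕ ((toℕ (a − b) + toℕ b) mod v)       ∎)
    from : ∀ {a} → a ≡ (toℕ g + toℕ b) mod v → g ≡ a − b
    from refl = toℕ-injective (begin
      toℕ g                                   ≡⟨ [[x+c]%v+d]%v≡x v (m+[n∸m]≡n (<⇒≤ (toℕ<n b))) (toℕ<n g) ⟨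
      ((toℕ g + toℕ b) % v + (v ∸ toℕ b)) % v ≡⟨ cong (λ z → (z + (v ∸ toℕ b)) % v) (toℕ-fromℕ< _) ⟨
      (toℕ ((toℕ g + toℕ b) mod v) + (v ∸ toℕ b)) % v ≡⟨ toℕ-− _ b ⟨
      toℕ (((toℕ g + toℕ b) mod v) − b)       ∎)

  g≡b−x⇔x≡b−g : {g b x : Fin v} → g ≡ b − x ⇔ x ≡ b − g
  g≡b−x⇔x≡b−g {g} {b} {x} =
    ⇔.trans g≡a−b⇔a≡g+b (⇔.trans (mk⇔ (λ e → trans e commute) (λ e → trans e (sym commute))) (⇔.sym g≡a−b⇔a≡g+b))
    where
    commute : (toℕ g + toℕ x) mod v ≡ (toℕ x + toℕ g) mod v
    commute = cong (_mod v) (+-comm (toℕ g) (toℕ x))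

module Window (v k M : ℕ) .{{_ : NonZero v}} .{{_ : NonZero k}} (Mk≡v : M * k ≡ v) where

  hits : ℕ → ℕ
  hits n = ∑[ a ∈ upTo M ] χ ((n + a * k) % v ℕ.<? k)

  0<M : 0 < M
  0<M = n≢0⇒n>0 λ M≡0 → ≢-nonZero⁻¹ v (trans (sym Mk≡v) (cong (_* k) M≡0))

  hits-+k : ∀ n → hits (n + k) ≡ hits n
  hits-+k n = begin
    hits (n + k)              ≡⟨ ∑-cong (upTo M) (λ {a} _ → cong (λ z → χ (z % v ℕ.<? k)) (+-assoc n k (a * k))) ⟩
    ∑[ a ∈ upTo M ] F (suc a) ≡⟨ ∑-rotate M F FM≡F0 ⟩
    hits n                    ∎
    where
    open ≡-Reasoning
    F : ℕ → ℕ
    F a = χ ((n + a * k) % v ℕ.<? k)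
    FM≡F0 : F M ≡ F 0
    FM≡F0 = cong (λ z → χ (z ℕ.<? k)) (begin
      (n + M * k) % v ≡⟨ cong (λ z → (n + z) % v) Mk≡v ⟩
      (n + v) % v     ≡⟨ [m+n]%n≡m%n n v ⟩
      n % v           ≡⟨ cong (_% v) (+-identityʳ n) ⟨
      (n + 0) % v     ∎)

  hits-+qk : ∀ r q → hits (r + q * k) ≡ hits r
  hits-+qk r zero    = cong hits (+-identityʳ r)
  hits-+qk r (suc q) = begin
    hits (r + (k + q * k)) ≡⟨ cong hits (trans (cong (r +_) (+-comm k (q * k))) (sym (+-assoc r (q * k) k))) ⟩
    hits (r + q * k + k)   ≡⟨ hits-+k (r + q * k) ⟩
    hits (r + q * k)       ≡⟨ hits-+qk r q ⟩
    hits r                 ∎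
    where open ≡-Reasoning

  in-window⇔first-block : ∀ {r a} → r < k → a < M → (r + a * k) % v < k ⇔ a ≡ 0
  in-window⇔first-block {r} {a} r<k a<M = mk⇔ (to r+ak<v) from
    where
    r+ak<v : r + a * k < v
    r+ak<v = subst (r + a * k <_) Mk≡v (<-≤-trans (+-monoˡ-< (a * k) r<k) (*-monoˡ-≤ k a<M))
    to : ∀ {a} → r + a * k < v → (r + a * k) % v < k → a ≡ 0
    to {zero}  _      _  = refl
    to {suc a} r+ak<v lt = contradiction (subst (_< k) (m<n⇒m%n≡m r+ak<v) lt) (≤⇒≯ (≤-trans (m≤m+n k (a * k)) (m≤n+m _ r)))
    from : ∀ {a} → a ≡ 0 → (r + a * k) % v < k
    from refl = ≤-<-trans (m%n≤m (r + 0) v) (subst (_< k) (sym (+-identityʳ r)) r<k)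

  hits-< : ∀ {r} → r < k → hits r ≡ 1
  hits-< {r} r<k = begin
    hits r                               ≡⟨ ∑-cong (upTo M) (λ a∈ → χ-cong _ _ (in-window⇔first-block r<k (∈-upTo⁻ a∈))) ⟩
    ∑[ a ∈ upTo M ] χ (a ℕ.≟ 0)          ≡⟨ ∑-upTo-indicator M 0 ⟩
    χ (0 ℕ.<? M)                         ≡⟨ χ-yes _ 0<M ⟩
    1                                    ∎
    where open ≡-Reasoning

  hits≡1 : ∀ n → hits n ≡ 1
  hits≡1 n = begin
    hits n                   ≡⟨ cong hits (m≡m%n+[m/n]*n n k) ⟩
    hits (n % k + n / k * k) ≡⟨ hits-+qk (n % k) (n / k) ⟩
    hits (n % k)             ≡⟨ hits-< (m%n<n n k) ⟩
    1                        ∎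
    where open ≡-Reasoning

module Construction (v k : ℕ) .{{_ : NonZero v}} .{{_ : NonZero k}} (k∣v : k ∣ v) (v∣k² : v ∣ k * k) where

  private
    M l : ℕ
    M = v / k
    l = (k * k) / v

    Mk≡v : M * k ≡ v
    Mk≡v = m/n*n≡m k∣v

  open Window v k M Mk≡v using (hits; hits≡1; 0<M)

  private
    lM≡k : l * M ≡ k
    lM≡k = *-cancelʳ-≡ (l * M) k k (begin
      l * M * k   ≡⟨ *-assoc l M k ⟩
      l * (M * k) ≡⟨ cong (l *_) Mk≡v ⟩
      l * v       ≡⟨ m/n*n≡m v∣k² ⟩
      k * k       ∎)
      where open ≡-Reasoning

    k≤v : k ≤ v
    k≤v = ∣⇒≤ k∣v

    l≤k : l ≤ k
    l≤k = subst (l ≤_) lM≡k (m≤m*n l M {{>-nonZero 0<M}})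

  ∑-AX : (F : Fin v → ℕ) → ∑ (AX v k) F ≡ ∑[ i ∈ upTo k ] F (i mod v)
  ∑-AX F = ∑-map _ (upTo k) F

  ∑-AY : (F : Fin v → ℕ) → ∑ (AY v k) F ≡ ∑[ a ∈ upTo M ] ∑[ t ∈ upTo l ] F ((a * k + t) mod v)
  ∑-AY F = trans (∑-concatMap _ (upTo M) F) (∑-cong (upTo M) λ _ → ∑-map _ (upTo l) F)

  ∑-AX-indicator : (w : Fin v) → ∑[ x ∈ AX v k ] χ (x ≟ w) ≡ χ (toℕ w ℕ.<? k)
  ∑-AX-indicator w = begin
    ∑[ x ∈ AX v k ] χ (x ≟ w)         ≡⟨ ∑-AX _ ⟩
    ∑[ i ∈ upTo k ] χ (i mod v ≟ w)   ≡⟨ ∑-cong (upTo k) (λ i∈ → χ-cong _ _ (mod≡⇔≡toℕ (<-≤-trans (∈-upTo⁻ i∈) k≤v))) ⟩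
    ∑[ i ∈ upTo k ] χ (i ℕ.≟ toℕ w)   ≡⟨ ∑-upTo-indicator k (toℕ w) ⟩
    χ (toℕ w ℕ.<? k)                  ∎
    where open ≡-Reasoning

  AY-translates-in-window : (c : ℕ) → ∑[ y ∈ AY v k ] χ ((c + toℕ y) % v ℕ.<? k) ≡ l
  AY-translates-in-window c = begin
    ∑[ y ∈ AY v k ] χ ((c + toℕ y) % v ℕ.<? k)
      ≡⟨ ∑-AY _ ⟩
    ∑[ a ∈ upTo M ] ∑[ t ∈ upTo l ] χ ((c + toℕ ((a * k + t) mod v)) % v ℕ.<? k)
      ≡⟨ ∑-cong (upTo M) (λ {a} _ → ∑-cong (upTo l) (λ {t} _ → cong (λ z → χ (z ℕ.<? k)) (regroup a t))) ⟩
    ∑[ a ∈ upTo M ] ∑[ t ∈ upTo l ] χ ((c + t + a * k) % v ℕ.<? k)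
      ≡⟨ ∑-swap (upTo M) (upTo l) _ ⟩
    ∑[ t ∈ upTo l ] hits (c + t)
      ≡⟨ ∑-cong (upTo l) (λ {t} _ → hits≡1 (c + t)) ⟩
    ∑[ t ∈ upTo l ] 1
      ≡⟨ ∑-const (upTo l) 1 ⟩
    length (upTo l) * 1
      ≡⟨ trans (*-identityʳ _) (length-upTo l) ⟩
    l ∎
    where
    open ≡-Reasoning
    regroup : ∀ a t → (c + toℕ ((a * k + t) mod v)) % v ≡ (c + t + a * k) % v
    regroup a t = begin
      (c + toℕ ((a * k + t) mod v)) % v ≡⟨ cong (λ z → (c + z) % v) (toℕ-fromℕ< _) ⟩
      (c + (a * k + t) % v) % v         ≡⟨ [m+n%d]%d≡[m+n]%d c (a * k + t) v ⟩
      (c + (a * k + t)) % v             ≡⟨ cong (λ z → (c + z) % v) (+-comm (a * k) t) ⟩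
      (c + (t + a * k)) % v             ≡⟨ cong (_% v) (+-assoc c t (a * k)) ⟨
      (c + t + a * k) % v               ∎

  count-Δ-AX-AY : (g : Fin v) → count g (Δ (AX v k) (AY v k)) ≡ l
  count-Δ-AX-AY g = begin
    count g (Δ (AX v k) (AY v k))                                 ≡⟨ count-Δ g (AX v k) (AY v k) ⟩
    ∑[ x ∈ AX v k ] ∑[ y ∈ AY v k ] χ (g ≟ x − y)                 ≡⟨ ∑-swap (AX v k) (AY v k) _ ⟩
    ∑[ y ∈ AY v k ] ∑[ x ∈ AX v k ] χ (g ≟ x − y)                 ≡⟨ ∑-cong (AY v k) (λ _ → ∑-cong (AX v k) (λ _ → χ-cong _ _ g≡a−b⇔a≡g+b)) ⟩
    ∑[ y ∈ AY v k ] ∑[ x ∈ AX v k ] χ (x ≟ (toℕ g + toℕ y) mod v) ≡⟨ ∑-cong (AY v k) (λ {y} _ → ∑-AX-indicator ((toℕ g + toℕ y) mod v)) ⟩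
    ∑[ y ∈ AY v k ] χ (toℕ ((toℕ g + toℕ y) mod v) ℕ.<? k)        ≡⟨ ∑-cong (AY v k) (λ _ → cong (λ z → χ (z ℕ.<? k)) (toℕ-fromℕ< _)) ⟩
    ∑[ y ∈ AY v k ] χ ((toℕ g + toℕ y) % v ℕ.<? k)                ≡⟨ AY-translates-in-window (toℕ g) ⟩
    l                                                             ∎
    where open ≡-Reasoning

  count-Δ-AY-AX : (g : Fin v) → count g (Δ (AY v k) (AX v k)) ≡ l
  count-Δ-AY-AX g = begin
    count g (Δ (AY v k) (AX v k))                          ≡⟨ count-Δ g (AY v k) (AX v k) ⟩
    ∑[ y ∈ AY v k ] ∑[ x ∈ AX v k ] χ (g ≟ y − x)          ≡⟨ ∑-cong (AY v k) (λ _ → ∑-cong (AX v k) (λ _ → χ-cong _ _ g≡b−x⇔x≡b−g)) ⟩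
    ∑[ y ∈ AY v k ] ∑[ x ∈ AX v k ] χ (x ≟ y − g)          ≡⟨ ∑-cong (AY v k) (λ {y} _ → ∑-AX-indicator (y − g)) ⟩
    ∑[ y ∈ AY v k ] χ (toℕ (y − g) ℕ.<? k)                 ≡⟨ ∑-cong (AY v k) (λ {y} _ → cong (λ z → χ (z ℕ.<? k)) (toℕ-−-comm y)) ⟩
    ∑[ y ∈ AY v k ] χ ((v ∸ toℕ g + toℕ y) % v ℕ.<? k)     ≡⟨ AY-translates-in-window (v ∸ toℕ g) ⟩
    l                                                      ∎
    where
    open ≡-Reasoning
    toℕ-−-comm : ∀ y → toℕ (y − g) ≡ (v ∸ toℕ g + toℕ y) % v
    toℕ-−-comm y = trans (toℕ-− y g) (cong (_% v) (+-comm (toℕ y) (v ∸ toℕ g)))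

  AX-isKSubset : IsKSubset k (AX v k)
  AX-isKSubset = unique , trans (length-map _ (upTo k)) (length-upTo k)
    where
    unique : Unique (AX v k)
    unique = subst Unique (sym (map-upTo _ k)) (Unique.applyUpTo⁺₁ _ k λ {i} {j} i<j j<k i≡j →
      <⇒≢ i<j (trans (Equivalence.to (mod≡⇔≡toℕ (<-≤-trans (<-trans i<j j<k) k≤v)) i≡j) (toℕ-mod (<-≤-trans j<k k≤v))))

  AY-isKSubset : IsKSubset k (AY v k)
  AY-isKSubset = Unique-concatMap (λ y → toℕ y / k) (Unique.upTo⁺ M) (All.applyUpTo⁺₁ _ M block-properties) , length-AY
    where
    block : ℕ → List (Fin v)
    block a = map (λ t → (a * k + t) mod v) (upTo l)

    block-properties : ∀ {a} → a < M → Unique (block a) × All (λ y → toℕ y / k ≡ a) (block a)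
    block-properties {a} a<M = unique , All.map⁺ (All.applyUpTo⁺₁ _ l block-index)
      where
      toℕ-block : ∀ {t} → t < l → toℕ ((a * k + t) mod v) ≡ a * k + t
      toℕ-block t<l = toℕ-mod (subst (a * k + _ <_) Mk≡v (begin-strict
        a * k + _ <⟨ +-monoʳ-< (a * k) (<-≤-trans t<l l≤k) ⟩
        a * k + k ≡⟨ +-comm (a * k) k ⟩
        suc a * k ≤⟨ *-monoˡ-≤ k a<M ⟩
        M * k     ∎))
        where open ≤-Reasoning
      unique : Unique (block a)
      unique = subst Unique (sym (map-upTo _ l)) (Unique.applyUpTo⁺₁ _ l λ {i} {j} i<j j<l i≡j →
        <⇒≢ i<j (+-cancelˡ-≡ (a * k) i j (trans (sym (toℕ-block (<-trans i<j j<l))) (trans (cong toℕ i≡j) (toℕ-block j<l)))))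
      block-index : ∀ {t} → t < l → toℕ ((a * k + t) mod v) / k ≡ a
      block-index {t} t<l = begin
        toℕ ((a * k + t) mod v) / k ≡⟨ cong (_/ k) (toℕ-block t<l) ⟩
        (a * k + t) / k             ≡⟨ +-distrib-/-∣ˡ t (n∣m*n a) ⟩
        a * k / k + t / k           ≡⟨ cong₂ _+_ (m*n/n≡m a k) (m<n⇒m/n≡0 (<-≤-trans t<l l≤k)) ⟩
        a + 0                       ≡⟨ +-identityʳ a ⟩
        a                           ∎
        where open ≡-Reasoning

    length-AY : length (AY v k) ≡ k
    length-AY = begin
      length (AY v k)                  ≡⟨ length-concatMap block (upTo M) ⟩
      ∑[ a ∈ upTo M ] length (block a) ≡⟨ ∑-cong (upTo M) (λ _ → trans (length-map _ (upTo l)) (length-upTo l)) ⟩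
      ∑[ a ∈ upTo M ] l                ≡⟨ ∑-const (upTo M) l ⟩
      length (upTo M) * l              ≡⟨ cong (_* l) (length-upTo M) ⟩
      M * l                            ≡⟨ *-comm M l ⟩
      l * M                            ≡⟨ lM≡k ⟩
      k                                ∎
      where open ≡-Reasoning

mainTheorem3 : (v k : ℕ) .{{_ : NonZero v}} .{{_ : NonZero k}} →
    v ∣ k * k → k ∣ v →
    IsPSEDF v 2 k ((k * k) / v) (family v k) ×
    IsNonDisjointSEDF v 2 k ((k * k) / v) (family v k)
mainTheorem3 v k v∣k² k∣v = (1<2 , isKSubset , pairs) , (1<2 , isKSubset , others)
  where
  open Construction v k k∣v v∣k²
  1<2 : 1 < 2
  1<2 = s<s z<s
  isKSubset : (i : Fin 2) → IsKSubset k (family v k i)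
  isKSubset Fin.zero    = AX-isKSubset
  isKSubset (Fin.suc _) = AY-isKSubset
  pairs : (i j : Fin 2) → i ≢ j → (g : Fin v) → count g (Δ (family v k i) (family v k j)) ≡ (k * k) / v
  pairs Fin.zero             Fin.zero             i≢j = contradiction refl i≢j
  pairs Fin.zero             (Fin.suc Fin.zero)   _   = count-Δ-AX-AY
  pairs (Fin.suc Fin.zero)   Fin.zero             _   = count-Δ-AY-AX
  pairs (Fin.suc Fin.zero)   (Fin.suc Fin.zero)   i≢j = contradiction refl i≢j
  others : (i : Fin 2) (g : Fin v) → count g (ΔOthers (family v k) i) ≡ (k * k) / v
  others Fin.zero           g = trans (cong (count g) (++-identityʳ (Δ (AX v k) (AY v k)))) (count-Δ-AX-AY g)
  others (Fin.suc Fin.zero) g = trans (cong (count g) (++-identityʳ (Δ (AY v k) (AX v k)))) (count-Δ-AY-AX g)
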